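{- Let $m$ be a positive integer and $x_1,\dotsc,x_m$ odd positive integers. The following are equivalent: (a) $x_1,\dotsc,x_m$ are (in order) the denominators of the odd greedy expansion of $\sum_{j=1}^m 1/x_j$. (b) For all positive integers $i,k$ with $i\le k\le m$, \[ 2\sigma_{k-i}(x_i,\dotsc, x_{k})>x_i^2\sigma_{k-i-1}(x_{i+1},\dotsc, x_{k}). \] (c) For all positive integers $i,k$ with $i<k\le m$, \[ x_k>\frac{(x_i-2)x_{i}\cdots x_{k-1}}{2\sigma_{k-i-1}(x_i,\dotsc, x_{k-1})-x_i^2\sigma_{k-i-2}(x_{i+1},\dotsc, x_{k-1})}. \]
   Context: $\sigma_k(y_1,\dots,y_r)=\sum_{I\subseteq\{1,\dots,r\},|I|=k}\prod_{i\in I}y_i$; $\sigma_0=1$ (also for an empty list of variables), $\sigma_k=0$ for $k<0$. Odd greedy expansion: given a positive rational $q$, define $x_1,x_2,\dots$ recursively: writing $R_i=q-\sum_{j=1}^{i-1}1/x_j$, if $R_i\ge1$ let $x_i=1$, and if $0<R_i<1$ let $x_i$ be the unique odd positive integer with $\frac1{x_i}\le R_i<\frac1{x_i-2}$; stop when the remainder is $0$. The $x_i$ are the denominators of the expansion. -}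

module Defs where

open import Data.Nat as ℕ using (ℕ; zero; suc)
open import Data.Integer as ℤ using (ℤ; +_; -[1+_])
open import Data.Rational as ℚ using (ℚ; 0ℚ; 1ℚ; _/_; ≢-nonZero)
open import Data.List using (List; []; _∷_; _++_; map; filter; length; applyUpTo; foldr)
open import Data.Nat.ListAction using (sum; product)
open import Data.Product using (Σ; ∃; _×_; _,_)
open import Data.Sum using (_⊎_)
open import Relation.Binary.PropositionalEquality using (_≡_; _≢_)

-- all sub-lists, i.e. one entry for each index subset I ⊆ {1..r}
sublists : {A : Set} → List A → List (List A)
sublists []       = [] ∷ []
sublists (y ∷ ys) = map (y ∷_) (sublists ys) ++ sublists ys

σ : ℕ → List ℕ → ℕ
σ k ys = sum (map product (filter (λ s → length s ℕ.≟ k) (sublists ys)))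

σℤ : ℤ → List ℕ → ℕ
σℤ (+ k)     ys = σ k ys
σℤ -[1+ _ ]  ys = 0

-- Sequences x_1, x_2, ... are functions ℕ → ℕ (only indices 1..m matter).

-- seg x i k = (x_i, x_{i+1}, ..., x_k)   (empty if k < i)
seg : (ℕ → ℕ) → ℕ → ℕ → List ℕ
seg x i k = applyUpTo (λ j → x (i ℕ.+ j)) (suc k ℕ.∸ i)

Odd : ℕ → Set
Odd n = ∃ λ t → n ≡ suc (2 ℕ.* t)

-- 1/n  (junk value 0 at n = 0; only used for positive n)
inv : ℕ → ℚ
inv zero    = 0ℚ
inv (suc n) = + 1 / suc n

-- 1/z for an integer z  (junk value 0 at z = 0; only used for z ≠ 0)
invℤ : ℤ → ℚ
invℤ (+ zero)    = 0ℚ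
invℤ (+ (suc n)) = + 1 / suc n
invℤ -[1+ n ]    = ℚ.- (+ 1 / suc n)

ℕ→ℚ : ℕ → ℚ
ℕ→ℚ n = + n / 1

sumℚ : List ℚ → ℚ
sumℚ = foldr ℚ._+_ 0ℚ

-- GreedyStep R x : x is the denominator chosen by the odd greedy
-- algorithm at remainder R (R ≥ 1 ⇒ x = 1; 0 < R < 1 ⇒ x is the odd
-- positive integer with 1/x ≤ R < 1/(x-2)).
GreedyStep : ℚ → ℕ → Set
GreedyStep R x =
  (1ℚ ℚ.≤ R × x ≡ 1)
  ⊎ (0ℚ ℚ.< R × R ℚ.< 1ℚ × Odd x × inv x ℚ.≤ R × R ℚ.< invℤ (+ x ℤ.- + 2))

GreedyFrom : ℚ → List ℕ → Set
GreedyFrom R []       = R ≡ 0ℚ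
GreedyFrom R (x ∷ xs) = GreedyStep R x × GreedyFrom (R ℚ.- inv x) xs

OddGreedyDenominators : ℚ → List ℕ → Set
OddGreedyDenominators q xs = GreedyFrom q xs

CondA : ℕ → (ℕ → ℕ) → Set
CondA m x = OddGreedyDenominators (sumℚ (map inv (seg x 1 m))) (seg x 1 m)

CondB : ℕ → (ℕ → ℕ) → Set
CondB m x = ∀ i k → 1 ℕ.≤ i → i ℕ.≤ k → k ℕ.≤ m →
  2 ℕ.* σℤ (+ k ℤ.- + i) (seg x i k)
    ℕ.> x i ℕ.^ 2 ℕ.* σℤ (+ k ℤ.- + i ℤ.- + 1) (seg x (suc i) k)

denomC : (ℕ → ℕ) → ℕ → ℕ → ℚ
denomC x i k =
  ℕ→ℚ 2 ℚ.* ℕ→ℚ (σℤ (+ k ℤ.- + i ℤ.- + 1) (seg x i (k ℕ.∸ 1)))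
  ℚ.- ℕ→ℚ (x i ℕ.^ 2) ℚ.* ℕ→ℚ (σℤ (+ k ℤ.- + i ℤ.- + 2) (seg x (suc i) (k ℕ.∸ 1)))

numerC : (ℕ → ℕ) → ℕ → ℕ → ℚ
numerC x i k = ((+ x i ℤ.- + 2) / 1) ℚ.* ℕ→ℚ (product (seg x i (k ℕ.∸ 1)))

CondC : ℕ → (ℕ → ℕ) → Set
CondC m x = ∀ i k → 1 ℕ.≤ i → i ℕ.< k → k ℕ.≤ m →
  Σ (denomC x i k ≢ 0ℚ) λ nz →
    ℕ→ℚ (x k) ℚ.> ℚ._÷_ (numerC x i k) (denomC x i k) {{≢-nonZero nz}}

-- Write S for the sum of the reciprocals of a tail L of positive integers, P for
-- its product and T = σ_{r-1}(L), so that S·P = T.  With remainder 1/y + S, the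
-- odd greedy algorithm picks an odd y ≥ 3 exactly when 1/y + S < 1/(y-2);
-- clearing denominators this is y²T < 2(yT + P) = 2σ_r(y, L), which is (b).
-- Hence (a) says that (b) holds for every tail of the sequence, and since the
-- greedy condition only weakens when the tail is shortened, it then holds for
-- every block x_i..x_k.  Finally, appending x_k to a block turns both sides of
-- (b) into affine functions of x_k, and (b) for the block without x_k makes the
-- coefficient (the denominator in (c)) positive, so (b) for i, k is (c).
module Submission where

open import Defs
open import Data.Nat as ℕ using (ℕ; zero; suc; _+_; _*_; _∸_; _^_; _≤_; _<_; z≤n; s≤s)
open import Data.Nat.Properties
open import Data.Nat.Coprimality using (1-coprimeTo)
import Data.Nat.Coprimality as Coprime
open import Data.Nat.ListAction using (sum; product)
open import Data.Nat.ListAction.Properties using (sum-++; product-++)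
open import Data.Nat.Tactic.RingSolver using (solve-∀)
open import Data.Integer as ℤ using (+_; -[1+_])
import Data.Integer.Properties as ℤ
open import Data.Rational as ℚ using (ℚ; mkℚ; 0ℚ; 1ℚ; _/_)
import Data.Rational.Properties as ℚ
open import Data.Rational.Solver using (module +-*-Solver)
open import Data.List using (List; []; _∷_; _++_; map; filter; length; applyUpTo)
open import Data.List.Properties using (filter-++; map-++)
open import Data.List.Relation.Unary.All using (All; []; _∷_)
open import Data.Bool using (true; false)
open import Relation.Nullary using (Dec)
open import Data.Empty using (⊥-elim)
open import Data.Unit using (⊤; tt)
open import Data.Product using (Σ; _×_; _,_; proj₁; proj₂)
open import Data.Sum using (inj₁; inj₂)
open import Function.Bundles using (_⇔_; mk⇔; module Equivalence)
open import Function.Related.Propositional using (module EquationalReasoning; SK-sym; K-reflexive)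
open import Relation.Binary.PropositionalEquality

open Equivalence using (to; from)

/1≡mkℚ : ∀ z → z / 1 ≡ mkℚ z 0 (Coprime.sym (1-coprimeTo ℤ.∣ z ∣))
/1≡mkℚ (+ n)    = ℚ.normalize-coprime (Coprime.sym (1-coprimeTo n))
/1≡mkℚ -[1+ n ] = cong ℚ.-_ (ℚ.normalize-coprime (Coprime.sym (1-coprimeTo (suc n))))

/1-+ : ∀ z w → (z ℤ.+ w) / 1 ≡ (z / 1) ℚ.+ (w / 1)
/1-+ z w rewrite /1≡mkℚ z | /1≡mkℚ w =
  cong (_/ 1) (cong₂ ℤ._+_ (sym (ℤ.*-identityʳ z)) (sym (ℤ.*-identityʳ w)))

/1-* : ∀ z w → (z ℤ.* w) / 1 ≡ (z / 1) ℚ.* (w / 1)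
/1-* z w rewrite /1≡mkℚ z | /1≡mkℚ w = refl

/1-neg : ∀ z → (ℤ.- z) / 1 ≡ ℚ.- (z / 1)
/1-neg (+ zero)   = refl
/1-neg (+ suc n)  rewrite /1≡mkℚ (+ suc n) = refl
/1-neg -[1+ n ]   rewrite /1≡mkℚ (+ suc n) = refl

/1-- : ∀ z w → (z ℤ.- w) / 1 ≡ (z / 1) ℚ.- (w / 1)
/1-- z w = trans (/1-+ z (ℤ.- w)) (cong ((z / 1) ℚ.+_) (/1-neg w))

ℕ→ℚ-+ : ∀ a b → ℕ→ℚ (a + b) ≡ ℕ→ℚ a ℚ.+ ℕ→ℚ b
ℕ→ℚ-+ a b = trans (cong (_/ 1) (ℤ.pos-+ a b)) (/1-+ (+ a) (+ b))

ℕ→ℚ-* : ∀ a b → ℕ→ℚ (a * b) ≡ ℕ→ℚ a ℚ.* ℕ→ℚ b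
ℕ→ℚ-* a b = trans (cong (_/ 1) (ℤ.pos-* a b)) (/1-* (+ a) (+ b))

ℕ→ℚ-^2 : ∀ a → ℕ→ℚ (a ^ 2) ≡ ℕ→ℚ a ℚ.* ℕ→ℚ a
ℕ→ℚ-^2 a = trans (ℕ→ℚ-* a (a * 1)) (cong (λ b → ℕ→ℚ a ℚ.* ℕ→ℚ b) (*-identityʳ a))

ℕ→ℚ-<⇔ : ∀ {a b} → (a < b) ⇔ (ℕ→ℚ a ℚ.< ℕ→ℚ b)
ℕ→ℚ-<⇔ {a} {b} rewrite /1≡mkℚ (+ a) | /1≡mkℚ (+ b) = mk⇔ mono cancel
  where
  mono : a < b → mkℚ (+ a) 0 _ ℚ.< mkℚ (+ b) 0 _
  mono a<b = ℚ.*<* (subst₂ ℤ._<_ (sym (ℤ.*-identityʳ (+ a))) (sym (ℤ.*-identityʳ (+ b))) (ℤ.+<+ a<b))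
  cancel : mkℚ (+ a) 0 _ ℚ.< mkℚ (+ b) 0 _ → a < b
  cancel (ℚ.*<* p) with subst₂ ℤ._<_ (ℤ.*-identityʳ (+ a)) (ℤ.*-identityʳ (+ b)) p
  ... | ℤ.+<+ a<b = a<b

ℕ→ℚ-pos : ∀ {a} → 0 < a → ℚ.Positive (ℕ→ℚ a)
ℕ→ℚ-pos 0<a = ℚ.positive (to ℕ→ℚ-<⇔ 0<a)

inv-inverseˡ : ∀ n → inv (suc n) ℚ.* ℕ→ℚ (suc n) ≡ 1ℚ
inv-inverseˡ n rewrite ℚ.normalize-coprime (1-coprimeTo (suc n)) | /1≡mkℚ (+ suc n) =
  ℚ.*-inverseˡ (mkℚ (+ suc n) 0 (Coprime.sym (1-coprimeTo (suc n))))

inv-pos : ∀ n → 0ℚ ℚ.< inv (suc n)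
inv-pos n rewrite ℚ.normalize-coprime (1-coprimeTo (suc n)) = ℚ.*<* (ℤ.+<+ (s≤s z≤n))

inv-nonNeg : ∀ n → 0ℚ ℚ.≤ inv n
inv-nonNeg zero    = ℚ.≤-refl
inv-nonNeg (suc n) = ℚ.<⇒≤ (inv-pos n)

inv≤1 : ∀ n → inv (suc n) ℚ.≤ 1ℚ
inv≤1 n rewrite ℚ.normalize-coprime (1-coprimeTo (suc n)) = ℚ.*≤* (ℤ.+≤+ (s≤s z≤n))

p≤p+q : ∀ p {q} → 0ℚ ℚ.≤ q → p ℚ.≤ p ℚ.+ q
p≤p+q p {q} 0≤q = subst (ℚ._≤ p ℚ.+ q) (ℚ.+-identityʳ p) (ℚ.+-monoʳ-≤ p 0≤q)

<⇔0<- : ∀ {p q} → (p ℚ.< q) ⇔ (0ℚ ℚ.< q ℚ.- p)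
<⇔0<- {p} {q} = mk⇔
  (λ p<q → subst (ℚ._< q ℚ.- p) (ℚ.+-inverseʳ p) (ℚ.+-monoˡ-< (ℚ.- p) p<q))
  (λ 0<q-p → subst₂ ℚ._<_ (ℚ.+-identityˡ p) (q-p+p≡q p q) (ℚ.+-monoˡ-< p 0<q-p))
  where
  open +-*-Solver
  q-p+p≡q : ∀ p q → q ℚ.- p ℚ.+ p ≡ q
  q-p+p≡q = solve 2 (λ p q → q :- p :+ p := q) refl

*-pos-<⇔ : ∀ c .{{_ : ℚ.Positive c}} {p q} → (p ℚ.< q) ⇔ (p ℚ.* c ℚ.< q ℚ.* c)
*-pos-<⇔ c = mk⇔ (ℚ.*-monoˡ-<-pos c) (ℚ.*-cancelʳ-<-nonNeg c {{ℚ.pos⇒nonNeg c}})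

÷<⇔<* : ∀ {u d z} .{{_ : ℚ.NonZero d}} → 0ℚ ℚ.< d →
  (ℚ._÷_ u d ℚ.< z) ⇔ (u ℚ.< z ℚ.* d)
÷<⇔<* {u} {d} {z} 0<d = begin
  u ℚ.÷ d ℚ.< z                 ∼⟨ *-pos-<⇔ d {{ℚ.positive 0<d}} ⟩
  u ℚ.÷ d ℚ.* d ℚ.< z ℚ.* d     ≡⟨ cong (ℚ._< z ℚ.* d) u÷d*d≡u ⟩
  u ℚ.< z ℚ.* d                 ∎
  where
  open EquationalReasoning
  u÷d*d≡u : u ℚ.÷ d ℚ.* d ≡ u
  u÷d*d≡u = trans (ℚ.*-assoc u (ℚ.1/ d) d)
                  (trans (cong (u ℚ.*_) (ℚ.*-inverseˡ d)) (ℚ.*-identityʳ u))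

σ-suc-∷ : ∀ k y L → σ (suc k) (y ∷ L) ≡ y * σ k L + σ (suc k) L
σ-suc-∷ k y L = begin
  sum (map product (filter (P (suc k)) (map (y ∷_) (sublists L) ++ sublists L)))
    ≡⟨ cong (λ S → sum (map product S)) (filter-++ (P (suc k)) (map (y ∷_) (sublists L)) (sublists L)) ⟩
  sum (map product (filter (P (suc k)) (map (y ∷_) (sublists L)) ++ filter (P (suc k)) (sublists L)))
    ≡⟨ cong sum (map-++ product (filter (P (suc k)) (map (y ∷_) (sublists L))) _) ⟩
  sum (map product (filter (P (suc k)) (map (y ∷_) (sublists L))) ++ map product (filter (P (suc k)) (sublists L)))
    ≡⟨ sum-++ (map product (filter (P (suc k)) (map (y ∷_) (sublists L)))) _ ⟩
  sum (map product (filter (P (suc k)) (map (y ∷_) (sublists L)))) + σ (suc k) L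
    ≡⟨ cong (λ S → sum (map product S) + σ (suc k) L) (filter-map-∷ (sublists L)) ⟩
  sum (map product (map (y ∷_) (filter (P k) (sublists L)))) + σ (suc k) L
    ≡⟨ cong (_+ σ (suc k) L) (sum-map-product-∷ (filter (P k) (sublists L))) ⟩
  y * σ k L + σ (suc k) L ∎
  where
  open ≡-Reasoning
  P : (k : ℕ) (s : List ℕ) → Dec (length s ≡ k)
  P k s = length s ℕ.≟ k
  filter-map-∷ : ∀ S → filter (P (suc k)) (map (y ∷_) S) ≡ map (y ∷_) (filter (P k) S)
  filter-map-∷ [] = refl
  filter-map-∷ (s ∷ S) with length s ℕ.≡ᵇ k
  ... | true  = cong ((y ∷ s) ∷_) (filter-map-∷ S)
  ... | false = filter-map-∷ S
  sum-map-product-∷ : ∀ S → sum (map product (map (y ∷_) S)) ≡ y * sum (map product S)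
  sum-map-product-∷ []      = sym (*-zeroʳ y)
  sum-map-product-∷ (s ∷ S) rewrite sum-map-product-∷ S = sym (*-distribˡ-+ y (product s) _)

σ-vanishes : ∀ k L → length L < k → σ k L ≡ 0
σ-vanishes (suc k) []      _         = refl
σ-vanishes (suc k) (y ∷ L) (s≤s L<k)
  rewrite σ-suc-∷ k y L | σ-vanishes k L L<k | σ-vanishes (suc k) L (m≤n⇒m≤1+n L<k) | *-zeroʳ y = refl

σ-length : ∀ L → σ (length L) L ≡ product L
σ-length []      = refl
σ-length (y ∷ L)
  rewrite σ-suc-∷ (length L) y L | σ-length L | σ-vanishes (suc (length L)) L ≤-refl = +-identityʳ _

-- σ′ L = σ_{r-1}(L) for L of length r ≥ 1
σ′ : List ℕ → ℕ
σ′ []      = 0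
σ′ (y ∷ L) = y * σ′ L + product L

σ-length-∷ : ∀ y L → σ (length L) (y ∷ L) ≡ σ′ (y ∷ L)
σ-length-∷ y []      rewrite *-zeroʳ y = refl
σ-length-∷ y (z ∷ L) rewrite σ-suc-∷ (length L) y (z ∷ L) | σ-length-∷ z L | σ-length (z ∷ L) = refl

σ′-∷ʳ : ∀ L z → σ′ (L ++ z ∷ []) ≡ z * σ′ L + product L
σ′-∷ʳ []      z = refl
σ′-∷ʳ (y ∷ L) z rewrite σ′-∷ʳ L z | product-++ L (z ∷ []) = identity y z (σ′ L) (product L)
  where
  identity : ∀ y z t p → y * (z * t + p) + p * (z * 1) ≡ z * (y * t + p) + y * p
  identity = solve-∀

sumInv : List ℕ → ℚ
sumInv L = sumℚ (map inv L)

sumInv-nonNeg : ∀ L → 0ℚ ℚ.≤ sumInv L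
sumInv-nonNeg []      = ℚ.≤-refl
sumInv-nonNeg (y ∷ L) = ℚ.≤-trans (inv-nonNeg y) (p≤p+q (inv y) (sumInv-nonNeg L))

sumInv-++ : ∀ L M → sumInv (L ++ M) ≡ sumInv L ℚ.+ sumInv M
sumInv-++ []      M = sym (ℚ.+-identityˡ _)
sumInv-++ (y ∷ L) M rewrite sumInv-++ L M = sym (ℚ.+-assoc (inv y) (sumInv L) (sumInv M))

product-pos : ∀ {L} → All (0 <_) L → 0 < product L
product-pos []       = s≤s z≤n
product-pos (p ∷ ps) = *-mono-< p (product-pos ps)

sumInv*product≡σ′ : ∀ {L} → All (0 <_) L → sumInv L ℚ.* ℕ→ℚ (product L) ≡ ℕ→ℚ (σ′ L)
sumInv*product≡σ′ []                   = refl
sumInv*product≡σ′ {suc y ∷ L} (_ ∷ ps) = begin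
  (inv (suc y) ℚ.+ S) ℚ.* ℕ→ℚ (suc y * P)
    ≡⟨ cong ((inv (suc y) ℚ.+ S) ℚ.*_) (ℕ→ℚ-* (suc y) P) ⟩
  (inv (suc y) ℚ.+ S) ℚ.* (Y ℚ.* ℕ→ℚ P)
    ≡⟨ distrib (inv (suc y)) S Y (ℕ→ℚ P) ⟩
  inv (suc y) ℚ.* Y ℚ.* ℕ→ℚ P ℚ.+ Y ℚ.* (S ℚ.* ℕ→ℚ P)
    ≡⟨ cong₂ (λ u v → u ℚ.* ℕ→ℚ P ℚ.+ Y ℚ.* v) (inv-inverseˡ y) (sumInv*product≡σ′ ps) ⟩
  1ℚ ℚ.* ℕ→ℚ P ℚ.+ Y ℚ.* ℕ→ℚ (σ′ L)
    ≡⟨ cong (ℚ._+ Y ℚ.* ℕ→ℚ (σ′ L)) (ℚ.*-identityˡ (ℕ→ℚ P)) ⟩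
  ℕ→ℚ P ℚ.+ Y ℚ.* ℕ→ℚ (σ′ L)
    ≡⟨ sym (trans (ℕ→ℚ-+ P (suc y * σ′ L)) (cong (ℕ→ℚ P ℚ.+_) (ℕ→ℚ-* (suc y) (σ′ L)))) ⟩
  ℕ→ℚ (P + suc y * σ′ L)
    ≡⟨ cong ℕ→ℚ (+-comm P (suc y * σ′ L)) ⟩
  ℕ→ℚ (σ′ (suc y ∷ L)) ∎
  where
  open ≡-Reasoning
  open +-*-Solver
  S = sumInv L
  P = product L
  Y = ℕ→ℚ (suc y)
  distrib : ∀ i s y p → (i ℚ.+ s) ℚ.* (y ℚ.* p) ≡ i ℚ.* y ℚ.* p ℚ.+ y ℚ.* (s ℚ.* p)
  distrib = solve 4 (λ i s y p → (i :+ s) :* (y :* p) := i :* y :* p :+ y :* (s :* p)) refl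

IneqB : ℕ → List ℕ → Set
IneqB y L = y ^ 2 * σ′ L < 2 * σ′ (y ∷ L)

IneqB-[] : ∀ y → IneqB y []
IneqB-[] y rewrite *-zeroʳ (y ^ 2) | *-zeroʳ y = s≤s z≤n

IneqB-1 : ∀ {L} → All (0 <_) L → IneqB 1 L
IneqB-1 {L} ps = subst (1 ^ 2 * σ′ L <_) (sym (identity (σ′ L) (product L)))
  (m<m+n (1 ^ 2 * σ′ L) (≤-trans (*-mono-< {0} {2} (s≤s z≤n) (product-pos ps)) (m≤n+m _ (σ′ L))))
  where
  identity : ∀ t p → 2 * (1 * t + p) ≡ 1 ^ 2 * t + (t + 2 * p)
  identity = solve-∀

-- 1/y + S < 1/(y-2) multiplied out by y(y-2)P, with y = 2 + b
clearDenominators⇔ : ∀ b P T →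
  (b * P + (2 + b) * b * T < (2 + b) * P) ⇔ ((2 + b) ^ 2 * T < 2 * ((2 + b) * T + P))
clearDenominators⇔ b P T = begin
  b * P + y * b * T < y * P                  ≡⟨ cong (b * P + y * b * T <_) (e₁ b P) ⟩
  b * P + y * b * T < b * P + 2 * P          ∼⟨ mk⇔ (+-cancelˡ-< (b * P) _ _) (+-monoʳ-< (b * P)) ⟩
  y * b * T < 2 * P                          ∼⟨ mk⇔ (+-monoˡ-< (2 * (y * T))) (+-cancelʳ-< (2 * (y * T)) _ _) ⟩
  y * b * T + 2 * (y * T) < 2 * P + 2 * (y * T) ≡⟨ cong₂ _<_ (e₂ b T) (e₃ b T P) ⟩
  y ^ 2 * T < 2 * (y * T + P)                ∎
  where
  open EquationalReasoning
  y = 2 + b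
  e₁ : ∀ b P → (2 + b) * P ≡ b * P + 2 * P
  e₁ = solve-∀
  e₂ : ∀ b T → (2 + b) * b * T + 2 * ((2 + b) * T) ≡ (2 + b) * ((2 + b) * 1) * T
  e₂ = solve-∀
  e₃ : ∀ b T P → 2 * P + 2 * ((2 + b) * T) ≡ 2 * ((2 + b) * T + P)
  e₃ = solve-∀

greedyBound⇔IneqB : ∀ a {L} → All (0 <_) L →
  (inv (3 + a) ℚ.+ sumInv L ℚ.< inv (suc a)) ⇔ IneqB (3 + a) L
greedyBound⇔IneqB a {L} ps = chain
  where
  y = 3 + a
  b = suc a
  S = sumInv L
  P = product L
  T = σ′ L
  Y = ℕ→ℚ y
  B = ℕ→ℚ b
  c = ℕ→ℚ (y * b * P)
  c-pos : ℚ.Positive c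
  c-pos = ℕ→ℚ-pos (*-mono-< (*-mono-< {0} {y} {0} {b} (s≤s z≤n) (s≤s z≤n)) (product-pos ps))
  c≡ : c ≡ Y ℚ.* B ℚ.* ℕ→ℚ P
  c≡ = trans (ℕ→ℚ-* (y * b) P) (cong (ℚ._* ℕ→ℚ P) (ℕ→ℚ-* y b))
  lhs≡ : (inv y ℚ.+ S) ℚ.* c ≡ ℕ→ℚ (b * P + y * b * T)
  lhs≡ = begin
    (inv y ℚ.+ S) ℚ.* c
      ≡⟨ cong ((inv y ℚ.+ S) ℚ.*_) c≡ ⟩
    (inv y ℚ.+ S) ℚ.* (Y ℚ.* B ℚ.* ℕ→ℚ P)
      ≡⟨ solve 5 (λ i s Y B P → (i :+ s) :* (Y :* B :* P) := i :* Y :* (B :* P) :+ Y :* B :* (s :* P))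
               refl (inv y) S Y B (ℕ→ℚ P) ⟩
    inv y ℚ.* Y ℚ.* (B ℚ.* ℕ→ℚ P) ℚ.+ Y ℚ.* B ℚ.* (S ℚ.* ℕ→ℚ P)
      ≡⟨ cong₂ (λ u v → u ℚ.* (B ℚ.* ℕ→ℚ P) ℚ.+ Y ℚ.* B ℚ.* v) (inv-inverseˡ (2 + a)) (sumInv*product≡σ′ ps) ⟩
    1ℚ ℚ.* (B ℚ.* ℕ→ℚ P) ℚ.+ Y ℚ.* B ℚ.* ℕ→ℚ T
      ≡⟨ cong (ℚ._+ Y ℚ.* B ℚ.* ℕ→ℚ T) (ℚ.*-identityˡ (B ℚ.* ℕ→ℚ P)) ⟩
    B ℚ.* ℕ→ℚ P ℚ.+ Y ℚ.* B ℚ.* ℕ→ℚ T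
      ≡⟨ sym (cong₂ ℚ._+_ (ℕ→ℚ-* b P) (trans (ℕ→ℚ-* (y * b) T) (cong (ℚ._* ℕ→ℚ T) (ℕ→ℚ-* y b)))) ⟩
    ℕ→ℚ (b * P) ℚ.+ ℕ→ℚ (y * b * T)
      ≡⟨ sym (ℕ→ℚ-+ (b * P) (y * b * T)) ⟩
    ℕ→ℚ (b * P + y * b * T) ∎
    where
    open ≡-Reasoning
    open +-*-Solver
  rhs≡ : inv b ℚ.* c ≡ ℕ→ℚ (y * P)
  rhs≡ = begin
    inv b ℚ.* c
      ≡⟨ cong (inv b ℚ.*_) c≡ ⟩
    inv b ℚ.* (Y ℚ.* B ℚ.* ℕ→ℚ P)
      ≡⟨ solve 4 (λ j Y B P → j :* (Y :* B :* P) := j :* B :* (Y :* P)) refl (inv b) Y B (ℕ→ℚ P) ⟩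
    inv b ℚ.* B ℚ.* (Y ℚ.* ℕ→ℚ P)
      ≡⟨ cong (ℚ._* (Y ℚ.* ℕ→ℚ P)) (inv-inverseˡ a) ⟩
    1ℚ ℚ.* (Y ℚ.* ℕ→ℚ P)
      ≡⟨ trans (ℚ.*-identityˡ (Y ℚ.* ℕ→ℚ P)) (sym (ℕ→ℚ-* y P)) ⟩
    ℕ→ℚ (y * P) ∎
    where
    open ≡-Reasoning
    open +-*-Solver
  chain : (inv y ℚ.+ S ℚ.< inv b) ⇔ IneqB y L
  chain = begin
    inv y ℚ.+ S ℚ.< inv b                      ∼⟨ *-pos-<⇔ c {{c-pos}} ⟩
    (inv y ℚ.+ S) ℚ.* c ℚ.< inv b ℚ.* c        ≡⟨ cong₂ ℚ._<_ lhs≡ rhs≡ ⟩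
    ℕ→ℚ (b * P + y * b * T) ℚ.< ℕ→ℚ (y * P)  ∼⟨ SK-sym ℕ→ℚ-<⇔ ⟩
    b * P + y * b * T < y * P                  ∼⟨ clearDenominators⇔ b P T ⟩
    IneqB y L                                  ∎
    where open EquationalReasoning

odd⇒inv-pos : ∀ {y} → Odd y → 0ℚ ℚ.< inv y
odd⇒inv-pos (t , refl) = inv-pos (2 * t)

greedyStep-mono : ∀ {R R′ y} → Odd y → inv y ℚ.≤ R′ → R′ ℚ.≤ R → GreedyStep R y → GreedyStep R′ y
greedyStep-mono _  1≤R′   _     (inj₁ (_ , refl)) = inj₁ (1≤R′ , refl)
greedyStep-mono od y⁻¹≤R′ R′≤R (inj₂ (_ , R<1 , _ , _ , R<bound)) =
  inj₂ ( ℚ.<-≤-trans (odd⇒inv-pos od) y⁻¹≤R′ , ℚ.≤-<-trans R′≤R R<1 , od , y⁻¹≤R′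
       , ℚ.≤-<-trans R′≤R R<bound)

greedyStep-++⁻ : ∀ {y} L M → Odd y →
  GreedyStep (inv y ℚ.+ sumInv (L ++ M)) y → GreedyStep (inv y ℚ.+ sumInv L) y
greedyStep-++⁻ {y} L M od = greedyStep-mono od (p≤p+q (inv y) (sumInv-nonNeg L)) (begin
  inv y ℚ.+ sumInv L                      ≤⟨ p≤p+q _ (sumInv-nonNeg M) ⟩
  inv y ℚ.+ sumInv L ℚ.+ sumInv M         ≡⟨ ℚ.+-assoc (inv y) (sumInv L) (sumInv M) ⟩
  inv y ℚ.+ (sumInv L ℚ.+ sumInv M)       ≡⟨ cong (inv y ℚ.+_) (sym (sumInv-++ L M)) ⟩
  inv y ℚ.+ sumInv (L ++ M)               ∎)
  where open ℚ.≤-Reasoning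

-- For y = 3 + a the bound invℤ (+ y ℤ.- + 2) of GreedyStep reduces to inv (suc a).
greedyStep⇔IneqB : ∀ y {L} → Odd y → All (0 <_) L →
  GreedyStep (inv y ℚ.+ sumInv L) y ⇔ IneqB y L
greedyStep⇔IneqB zero    (_ , ())
greedyStep⇔IneqB 1 {L}   _         ps =
  mk⇔ (λ _ → IneqB-1 ps) (λ _ → inj₁ (p≤p+q 1ℚ (sumInv-nonNeg L) , refl))
greedyStep⇔IneqB 2       (t , 2≡odd) = ⊥-elim (even≢odd 1 t 2≡odd)
greedyStep⇔IneqB (suc (suc (suc a))) {L} od ps = mk⇔ to′ from′
  where
  y = 3 + a
  to′ : GreedyStep (inv y ℚ.+ sumInv L) y → IneqB y L
  to′ (inj₁ (_ , ()))
  to′ (inj₂ (_ , _ , _ , _ , R<bound)) = to (greedyBound⇔IneqB a ps) R<bound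
  from′ : IneqB y L → GreedyStep (inv y ℚ.+ sumInv L) y
  from′ ineq = inj₂ ( ℚ.<-≤-trans (inv-pos (2 + a)) y⁻¹≤R , ℚ.<-≤-trans R<bound (inv≤1 a)
                    , od , y⁻¹≤R , R<bound)
    where
    R<bound = from (greedyBound⇔IneqB a ps) ineq
    y⁻¹≤R = p≤p+q (inv y) (sumInv-nonNeg L)

GreedySteps : List ℕ → Set
GreedySteps []      = ⊤
GreedySteps (y ∷ L) = GreedyStep (inv y ℚ.+ sumInv L) y × GreedySteps L

greedyFrom-sumInv⇔GreedySteps : ∀ L → GreedyFrom (sumInv L) L ⇔ GreedySteps L
greedyFrom-sumInv⇔GreedySteps []      = mk⇔ (λ _ → tt) (λ _ → refl)
greedyFrom-sumInv⇔GreedySteps (y ∷ L) = mk⇔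
  (λ (step , rest) → step , to IH (subst (λ R → GreedyFrom R L) remainder≡ rest))
  (λ (step , rest) → step , subst (λ R → GreedyFrom R L) (sym remainder≡) (from IH rest))
  where
  IH = greedyFrom-sumInv⇔GreedySteps L
  open +-*-Solver
  remainder≡ : inv y ℚ.+ sumInv L ℚ.- inv y ≡ sumInv L
  remainder≡ = solve 2 (λ p q → p :+ q :- p := q) refl (inv y) (sumInv L)

denom : ℕ → List ℕ → ℚ
denom y L = ℕ→ℚ 2 ℚ.* ℕ→ℚ (σ′ (y ∷ L)) ℚ.- ℕ→ℚ (y ^ 2) ℚ.* ℕ→ℚ (σ′ L)

numer : ℕ → List ℕ → ℚ
numer y L = ((+ y ℤ.- + 2) / 1) ℚ.* ℕ→ℚ (product (y ∷ L))

ExceedsQuotient : ℚ → ℚ → ℚ → Set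
ExceedsQuotient z u d = Σ (d ≢ 0ℚ) λ d≢0 → z ℚ.> ℚ._÷_ u d {{ℚ.≢-nonZero d≢0}}

IneqC : ℕ → List ℕ → ℕ → Set
IneqC y L z = ExceedsQuotient (ℕ→ℚ z) (numer y L) (denom y L)

IneqB⇔0<denom : ∀ y L → IneqB y L ⇔ (0ℚ ℚ.< denom y L)
IneqB⇔0<denom y L = begin
  y ^ 2 * σ′ L < 2 * σ′ (y ∷ L)                                 ∼⟨ ℕ→ℚ-<⇔ ⟩
  ℕ→ℚ (y ^ 2 * σ′ L) ℚ.< ℕ→ℚ (2 * σ′ (y ∷ L))                 ∼⟨ <⇔0<- ⟩
  0ℚ ℚ.< ℕ→ℚ (2 * σ′ (y ∷ L)) ℚ.- ℕ→ℚ (y ^ 2 * σ′ L)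
    ≡⟨ cong (0ℚ ℚ.<_) (cong₂ ℚ._-_ (ℕ→ℚ-* 2 (σ′ (y ∷ L))) (ℕ→ℚ-* (y ^ 2) (σ′ L))) ⟩
  0ℚ ℚ.< denom y L                                              ∎
  where open EquationalReasoning

IneqB-∷ʳ⇔ : ∀ y L z → IneqB y (L ++ z ∷ []) ⇔ (numer y L ℚ.< ℕ→ℚ z ℚ.* denom y L)
IneqB-∷ʳ⇔ y L z = chain
  where
  T = σ′ L
  P = product L
  two = ℕ→ℚ 2
  Y = ℕ→ℚ y
  Z = ℕ→ℚ z
  S = ℕ→ℚ (σ′ (y ∷ L))
  ℕ→ℚ-*[*+] : ∀ a b c d → ℕ→ℚ (a * (b * c + d)) ≡ ℕ→ℚ a ℚ.* (ℕ→ℚ b ℚ.* ℕ→ℚ c ℚ.+ ℕ→ℚ d)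
  ℕ→ℚ-*[*+] a b c d =
    trans (ℕ→ℚ-* a _) (cong (ℕ→ℚ a ℚ.*_) (trans (ℕ→ℚ-+ (b * c) d) (cong (ℚ._+ ℕ→ℚ d) (ℕ→ℚ-* b c))))
  difference≡ : ℕ→ℚ (2 * (z * σ′ (y ∷ L) + y * P)) ℚ.- ℕ→ℚ (y ^ 2 * (z * T + P))
              ≡ Z ℚ.* denom y L ℚ.- numer y L
  difference≡ = begin
    ℕ→ℚ (2 * (z * σ′ (y ∷ L) + y * P)) ℚ.- ℕ→ℚ (y ^ 2 * (z * T + P))
      ≡⟨ cong₂ ℚ._-_
           (trans (ℕ→ℚ-*[*+] 2 z (σ′ (y ∷ L)) (y * P)) (cong (λ q → two ℚ.* (Z ℚ.* S ℚ.+ q)) (ℕ→ℚ-* y P)))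
           (trans (ℕ→ℚ-*[*+] (y ^ 2) z T P) (cong (ℚ._* (Z ℚ.* ℕ→ℚ T ℚ.+ ℕ→ℚ P)) (ℕ→ℚ-^2 y))) ⟩
    two ℚ.* (Z ℚ.* S ℚ.+ Y ℚ.* ℕ→ℚ P) ℚ.- Y ℚ.* Y ℚ.* (Z ℚ.* ℕ→ℚ T ℚ.+ ℕ→ℚ P)
      ≡⟨ solve 6 (λ two Z S T P Y →
                    two :* (Z :* S :+ Y :* P) :- Y :* Y :* (Z :* T :+ P)
                    := Z :* (two :* S :- Y :* Y :* T) :- (Y :- two) :* (Y :* P))
               refl two Z S (ℕ→ℚ T) (ℕ→ℚ P) Y ⟩
    Z ℚ.* (two ℚ.* S ℚ.- Y ℚ.* Y ℚ.* ℕ→ℚ T) ℚ.- (Y ℚ.- two) ℚ.* (Y ℚ.* ℕ→ℚ P)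
      ≡⟨ sym (cong₂ (λ u v → Z ℚ.* (two ℚ.* S ℚ.- u ℚ.* ℕ→ℚ T) ℚ.- v)
                    (ℕ→ℚ-^2 y) (cong₂ ℚ._*_ (/1-- (+ y) (+ 2)) (ℕ→ℚ-* y P))) ⟩
    Z ℚ.* denom y L ℚ.- numer y L ∎
    where
    open ≡-Reasoning
    open +-*-Solver
  chain : IneqB y (L ++ z ∷ []) ⇔ (numer y L ℚ.< ℕ→ℚ z ℚ.* denom y L)
  chain = begin
    IneqB y (L ++ z ∷ [])
      ≡⟨ cong₂ (λ u v → y ^ 2 * u < 2 * v) (σ′-∷ʳ L z) (σ′-∷ʳ (y ∷ L) z) ⟩
    y ^ 2 * (z * T + P) < 2 * (z * σ′ (y ∷ L) + product (y ∷ L))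
      ∼⟨ ℕ→ℚ-<⇔ ⟩
    ℕ→ℚ (y ^ 2 * (z * T + P)) ℚ.< ℕ→ℚ (2 * (z * σ′ (y ∷ L) + y * P))
      ∼⟨ <⇔0<- ⟩
    0ℚ ℚ.< ℕ→ℚ (2 * (z * σ′ (y ∷ L) + y * P)) ℚ.- ℕ→ℚ (y ^ 2 * (z * T + P))
      ≡⟨ cong (0ℚ ℚ.<_) difference≡ ⟩
    0ℚ ℚ.< ℕ→ℚ z ℚ.* denom y L ℚ.- numer y L
      ∼⟨ SK-sym <⇔0<- ⟩
    numer y L ℚ.< ℕ→ℚ z ℚ.* denom y L ∎
    where open EquationalReasoning

IneqB-∷ʳ⇔IneqC : ∀ y L z → IneqB y L → IneqB y (L ++ z ∷ []) ⇔ IneqC y L z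
IneqB-∷ʳ⇔IneqC y L z ineq = mk⇔
  (λ ineq′ → d≢0 , from (÷<⇔<* {{ℚ.≢-nonZero d≢0}} 0<d) (to (IneqB-∷ʳ⇔ y L z) ineq′))
  (λ (d≢0′ , z>u/d) → from (IneqB-∷ʳ⇔ y L z) (to (÷<⇔<* {{ℚ.≢-nonZero d≢0′}} 0<d) z>u/d))
  where
  0<d = to (IneqB⇔0<denom y L) ineq
  d≢0 : denom y L ≢ 0ℚ
  d≢0 d≡0 = ℚ.<⇒≢ 0<d (sym d≡0)

+[m+n]-m≡n : ∀ m n → + (m + n) ℤ.- + m ≡ + n
+[m+n]-m≡n m n = trans (ℤ.m-n≡m⊖n (m + n) m) (trans (ℤ.⊖-≥ (m≤m+n m n)) (cong +_ (m+n∸m≡n m n)))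

+[1+m+n]-m≡1+n : ∀ m n → + suc (m + n) ℤ.- + m ≡ + suc n
+[1+m+n]-m≡1+n m n = trans (cong (λ k → + k ℤ.- + m) (sym (+-suc m n))) (+[m+n]-m≡n m (suc n))

reindexByLength : ∀ {P Q : ℕ → ℕ → Set} d m → (∀ i n → P i (d + i + n) ⇔ Q i n) →
  (∀ i k → 1 ≤ i → d + i ≤ k → k ≤ m → P i k) ⇔ (∀ i n → 1 ≤ i → d + i + n ≤ m → Q i n)
reindexByLength {P} d m P⇔Q = mk⇔
  (λ h i n 1≤i k≤m → to (P⇔Q i n) (h i (d + i + n) 1≤i (m≤m+n (d + i) n) k≤m))
  (λ h i k 1≤i d+i≤k k≤m → subst (P i) (m+[n∸m]≡n d+i≤k)
     (from (P⇔Q i (k ∸ (d + i))) (h i (k ∸ (d + i)) 1≤i (subst (_≤ m) (sym (m+[n∸m]≡n d+i≤k)) k≤m))))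

slice : (ℕ → ℕ) → ℕ → ℕ → List ℕ
slice x i zero    = []
slice x i (suc n) = x i ∷ slice x (suc i) n

OddPositive : ℕ → (ℕ → ℕ) → Set
OddPositive m x = ∀ j → 1 ≤ j → j ≤ m → 0 < x j × Odd (x j)

GreedyStepAt : (ℕ → ℕ) → ℕ → ℕ → Set
GreedyStepAt x j r = GreedyStep (inv (x j) ℚ.+ sumInv (slice x (suc j) r)) (x j)

AllIneqB : ℕ → (ℕ → ℕ) → Set
AllIneqB m x = ∀ i n → 1 ≤ i → i + n ≤ m → IneqB (x i) (slice x (suc i) n)

AllIneqC : ℕ → (ℕ → ℕ) → Set
AllIneqC m x = ∀ i n → 1 ≤ i → suc (i + n) ≤ m → IneqC (x i) (slice x (suc i) n) (x (suc (i + n)))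

module _ (x : ℕ → ℕ) where

  applyUpTo≡slice : ∀ {f} i n → (∀ j → f j ≡ x (i + j)) → applyUpTo f n ≡ slice x i n
  applyUpTo≡slice i zero    _  = refl
  applyUpTo≡slice i (suc n) f≗ = cong₂ _∷_ (trans (f≗ 0) (cong x (+-identityʳ i)))
    (applyUpTo≡slice (suc i) n (λ j → trans (f≗ (suc j)) (cong x (+-suc i j))))

  seg≡slice : ∀ i k → seg x i k ≡ slice x i (suc k ∸ i)
  seg≡slice i k = applyUpTo≡slice i (suc k ∸ i) (λ _ → refl)

  seg≡slice-block : ∀ i n → seg x i (i + n) ≡ slice x i (suc n)
  seg≡slice-block i n = trans (seg≡slice i (i + n))
    (cong (slice x i) (trans (cong (_∸ i) (sym (+-suc i n))) (m+n∸m≡n i (suc n))))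

  seg≡slice-tail : ∀ i n → seg x (suc i) (i + n) ≡ slice x (suc i) n
  seg≡slice-tail i n = trans (seg≡slice (suc i) (i + n)) (cong (slice x (suc i)) (m+n∸m≡n i n))

  length-slice : ∀ i n → length (slice x i n) ≡ n
  length-slice i zero    = refl
  length-slice i (suc n) = cong suc (length-slice (suc i) n)

  slice-++ : ∀ i n p → slice x i (n + p) ≡ slice x i n ++ slice x (i + n) p
  slice-++ i zero    p = cong (λ j → slice x j p) (sym (+-identityʳ i))
  slice-++ i (suc n) p = cong (x i ∷_)
    (trans (slice-++ (suc i) n p) (cong (λ j → slice x (suc i) n ++ slice x j p) (sym (+-suc i n))))

  slice-∷ʳ : ∀ i n → slice x i (suc n) ≡ slice x i n ++ x (i + n) ∷ []
  slice-∷ʳ i n = trans (cong (slice x i) (+-comm 1 n)) (slice-++ i n 1)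

  All-slice : ∀ {P : ℕ → Set} i n → (∀ j → i ≤ j → j < i + n → P (x j)) → All P (slice x i n)
  All-slice i zero    _ = []
  All-slice i (suc n) h = h i ≤-refl (m<m+n i (s≤s z≤n))
    ∷ All-slice (suc i) n (λ j i<j j<1+i+n → h j (<⇒≤ i<j) (subst (j <_) (sym (+-suc i n)) j<1+i+n))

  σℤ-slice : ∀ i n {z} → z ≡ + n ℤ.- + 1 → σℤ z (slice x i n) ≡ σ′ (slice x i n)
  σℤ-slice i zero    refl = refl
  σℤ-slice i (suc n) refl =
    subst (λ k → σ k (slice x i (suc n)) ≡ σ′ (slice x i (suc n)))
          (length-slice (suc i) n) (σ-length-∷ (x i) (slice x (suc i) n))

  σℤ-seg : ∀ {z L} i n → L ≡ slice x i n → z ≡ + n ℤ.- + 1 → σℤ z L ≡ σ′ (slice x i n)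
  σℤ-seg i n refl = σℤ-slice i n

  condB⇔ : ∀ m → CondB m x ⇔ AllIneqB m x
  condB⇔ m = reindexByLength 0 m λ i n → K-reflexive (cong₂ (λ t b → x i ^ 2 * t < 2 * b)
    (σℤ-seg (suc i) n (seg≡slice-tail i n) (cong (ℤ._- + 1) (+[m+n]-m≡n i n)))
    (σℤ-seg i (suc n) (seg≡slice-block i n) (+[m+n]-m≡n i n)))

  condC⇔ : ∀ m → CondC m x ⇔ AllIneqC m x
  condC⇔ m = reindexByLength 1 m λ i n →
    K-reflexive (cong₂ (ExceedsQuotient (ℕ→ℚ (x (suc (i + n))))) (numer≡ i n) (denom≡ i n))
    where
    numer≡ : ∀ i n → numerC x i (suc (i + n)) ≡ numer (x i) (slice x (suc i) n)
    numer≡ i n = cong (λ L → ((+ x i ℤ.- + 2) / 1) ℚ.* ℕ→ℚ (product L)) (seg≡slice-block i n)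
    denom≡ : ∀ i n → denomC x i (suc (i + n)) ≡ denom (x i) (slice x (suc i) n)
    denom≡ i n = cong₂ (λ b t → ℕ→ℚ 2 ℚ.* ℕ→ℚ b ℚ.- ℕ→ℚ (x i ^ 2) ℚ.* ℕ→ℚ t) σ-block σ-tail
      where
      σ-block : σℤ (+ suc (i + n) ℤ.- + i ℤ.- + 1) (seg x i (i + n)) ≡ σ′ (slice x i (suc n))
      σ-block = σℤ-seg i (suc n) (seg≡slice-block i n) (cong (ℤ._- + 1) (+[1+m+n]-m≡1+n i n))
      σ-tail : σℤ (+ suc (i + n) ℤ.- + i ℤ.- + 2) (seg x (suc i) (i + n)) ≡ σ′ (slice x (suc i) n)
      σ-tail = σℤ-seg (suc i) n (seg≡slice-tail i n)
        (trans (cong (ℤ._- + 2) (+[1+m+n]-m≡1+n i n)) (ℤ.[1+m]⊖[1+n]≡m⊖n n 1))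

  greedySteps-slice⇔ : ∀ i n →
    GreedySteps (slice x i n) ⇔ (∀ d r → suc (d + r) ≡ n → GreedyStepAt x (i + d) r)
  greedySteps-slice⇔ i zero    = mk⇔ (λ _ _ _ ()) (λ _ → tt)
  greedySteps-slice⇔ i (suc n) = mk⇔ to′ from′
    where
    IH = greedySteps-slice⇔ (suc i) n
    to′ : GreedySteps (slice x i (suc n)) → ∀ d r → suc (d + r) ≡ suc n → GreedyStepAt x (i + d) r
    to′ (step , _)     zero    r refl = subst (λ j → GreedyStepAt x j r) (sym (+-identityʳ i)) step
    to′ (_    , steps) (suc d) r eq   =
      subst (λ j → GreedyStepAt x j r) (sym (+-suc i d)) (to IH steps d r (suc-injective eq))
    from′ : (∀ d r → suc (d + r) ≡ suc n → GreedyStepAt x (i + d) r) → GreedySteps (slice x i (suc n))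
    from′ h = subst (λ j → GreedyStepAt x j n) (+-identityʳ i) (h 0 n refl)
            , from IH (λ d r eq → subst (λ j → GreedyStepAt x j r) (+-suc i d) (h (suc d) r (cong suc eq)))

  condA⇔ : ∀ m → CondA m x ⇔ GreedySteps (slice x 1 m)
  condA⇔ m rewrite seg≡slice 1 m = greedyFrom-sumInv⇔GreedySteps (slice x 1 m)

  greedySteps⇔AllIneqB : ∀ m → OddPositive m x → GreedySteps (slice x 1 m) ⇔ AllIneqB m x
  greedySteps⇔AllIneqB m hyp = mk⇔
    (λ steps → to′ (to (greedySteps-slice⇔ 1 m) steps))
    (λ ineqs → from (greedySteps-slice⇔ 1 m) (from′ ineqs))
    where
    odd : ∀ {i n} → 1 ≤ i → i + n ≤ m → Odd (x i)
    odd {i} {n} 1≤i i+n≤m = proj₂ (hyp i 1≤i (≤-trans (m≤m+n i n) i+n≤m))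
    positive : ∀ {i n} → 1 ≤ i → i + n ≤ m → All (0 <_) (slice x (suc i) n)
    positive {i} {n} 1≤i i+n≤m = All-slice (suc i) n λ j i<j j≤i+n →
      proj₁ (hyp j (≤-trans (s≤s z≤n) i<j) (≤-trans (≤-pred j≤i+n) i+n≤m))
    step⇔ineq : ∀ i n → 1 ≤ i → i + n ≤ m → GreedyStepAt x i n ⇔ IneqB (x i) (slice x (suc i) n)
    step⇔ineq i n 1≤i i+n≤m = greedyStep⇔IneqB (x i) (odd 1≤i i+n≤m) (positive 1≤i i+n≤m)
    to′ : (∀ d r → suc (d + r) ≡ m → GreedyStepAt x (suc d) r) → AllIneqB m x
    to′ h (suc d) n 1≤i i+n≤m = to (step⇔ineq (suc d) n 1≤i i+n≤m)
      (greedyStep-++⁻ (slice x (2 + d) n) (slice x (2 + d + n) p) (odd 1≤i i+n≤m)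
        (subst (λ L → GreedyStep (inv (x (suc d)) ℚ.+ sumInv L) (x (suc d))) (slice-++ (2 + d) n p)
          (h d (n + p) (trans (cong suc (sym (+-assoc d n p))) (m+[n∸m]≡n i+n≤m)))))
      where p = m ∸ (suc d + n)
    from′ : AllIneqB m x → ∀ d r → suc (d + r) ≡ m → GreedyStepAt x (suc d) r
    from′ ineqs d r eq =
      from (step⇔ineq (suc d) r (s≤s z≤n) (≤-reflexive eq)) (ineqs (suc d) r (s≤s z≤n) (≤-reflexive eq))

  AllIneqB⇔AllIneqC : ∀ m → AllIneqB m x ⇔ AllIneqC m x
  AllIneqB⇔AllIneqC m = mk⇔ to′ from′
    where
    extend : ∀ i n → IneqB (x i) (slice x (suc i) n) →
      IneqB (x i) (slice x (suc i) (suc n)) ⇔ IneqC (x i) (slice x (suc i) n) (x (suc (i + n)))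
    extend i n ineq = subst (λ L → IneqB (x i) L ⇔ IneqC (x i) (slice x (suc i) n) (x (suc (i + n))))
      (sym (slice-∷ʳ (suc i) n)) (IneqB-∷ʳ⇔IneqC (x i) (slice x (suc i) n) (x (suc (i + n))) ineq)
    to′ : AllIneqB m x → AllIneqC m x
    to′ ineqs i n 1≤i k≤m = to (extend i n (ineqs i n 1≤i (≤-trans (n≤1+n _) k≤m)))
      (ineqs i (suc n) 1≤i (subst (_≤ m) (sym (+-suc i n)) k≤m))
    from′ : AllIneqC m x → AllIneqB m x
    from′ ineqs i zero    _   _         = IneqB-[] (x i)
    from′ ineqs i (suc n) 1≤i i+1+n≤m = from (extend i n (from′ ineqs i n 1≤i (≤-trans (n≤1+n _) k≤m)))
      (ineqs i n 1≤i k≤m)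
      where
      k≤m : suc (i + n) ≤ m
      k≤m = subst (_≤ m) (+-suc i n) i+1+n≤m

proposition3p1 : (m : ℕ) (x : ℕ → ℕ) → 1 ≤ m →
    (∀ j → 1 ≤ j → j ≤ m → 0 < x j × Odd (x j)) →
    (CondA m x ⇔ CondB m x) × (CondB m x ⇔ CondC m x)
proposition3p1 m x _ hyp = A⇔B , B⇔C
  where
  open EquationalReasoning
  A⇔B : CondA m x ⇔ CondB m x
  A⇔B = begin
    CondA m x                  ∼⟨ condA⇔ x m ⟩
    GreedySteps (slice x 1 m)  ∼⟨ greedySteps⇔AllIneqB x m hyp ⟩
    AllIneqB m x               ∼⟨ SK-sym (condB⇔ x m) ⟩
    CondB m x                  ∎
  B⇔C : CondB m x ⇔ CondC m x
  B⇔C = begin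
    CondB m x     ∼⟨ condB⇔ x m ⟩
    AllIneqB m x  ∼⟨ AllIneqB⇔AllIneqC x m ⟩
    AllIneqC m x  ∼⟨ SK-sym (condC⇔ x m) ⟩
    CondC m x     ∎
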